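{- Let $d\in\mathbb{N}$ and let $F$ be a finite field. Then for each set $B\subset F^d$ with $|B|>\sqrt6\,|F|^{d-1/2}$ and any $\alpha=(\alpha_1,\dots,\alpha_d)\in(F^*)^d$ there exist $y=(y_1,\dots,y_d)\in F^d$ and $u\in F^*$ such that both $y+u\alpha:=(y_1+u\alpha_1,\dots,y_d+u\alpha_d)$ and $yu:=(y_1u,\dots,y_du)$ belong to $B$.
   Context: $F^*=F\setminus\{0\}$. -}

module Defs where

open import Data.Nat using (ℕ)
open import Data.Fin using (Fin)
open import Data.Bool using (Bool; true; false)
open import Data.List using (List; []; _∷_; map; concatMap; length; filter; allFin)
open import Data.Vec using (Vec; []; _∷_)
open import Data.Product using (∃)
open import Function.Bundles using (_↔_; Inverse)
open import Relation.Nullary using (¬_)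
open import Relation.Binary.PropositionalEquality using (_≡_)
open import Algebra.Structures using (IsCommutativeRing)
open import Relation.Binary.Definitions using (DecidableEquality)

-- The carrier's equality is propositional equality
-- (harmless for finite structures: one may always take canonical
-- representatives), it is a commutative ring with 0 ≠ 1 in which every
-- nonzero element has a multiplicative inverse, and it is finite:
-- in bijection with Fin size.
record FiniteField : Set₁ where
  field
    Carrier  : Set
    _+_      : Carrier → Carrier → Carrier
    _*_      : Carrier → Carrier → Carrier
    -_       : Carrier → Carrier
    0#       : Carrier
    1#       : Carrier
    isCommutativeRing : IsCommutativeRing _≡_ _+_ _*_ -_ 0# 1#
    0≢1      : ¬ (0# ≡ 1#)
    inverse  : ∀ x → ¬ (x ≡ 0#) → ∃ λ y → (x * y) ≡ 1#
    size     : ℕ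
    enum     : Carrier ↔ Fin size

  infixl 7 _*_
  infixl 6 _+_

  card : ℕ
  card = size

  elements : List Carrier
  elements = map (Inverse.from enum) (allFin size)

  allVecs : (d : ℕ) → List (Vec Carrier d)
  allVecs ℕ.zero    = [] ∷ []
  allVecs (ℕ.suc d) = concatMap (λ x → map (x ∷_) (allVecs d)) elements

  Subset : ℕ → Set
  Subset d = Vec Carrier d → Bool

  _∈_ : ∀ {d} → Vec Carrier d → Subset d → Set
  v ∈ B = B v ≡ true

  ∣_∣ : ∀ {d} → Subset d → ℕ
  ∣_∣ {d} B = length (filter (λ v → Data.Bool._≟_ (B v) true) (allVecs d))

  Nonzero : Carrier → Set
  Nonzero x = ¬ (x ≡ 0#)

  _+ᵛ_ : ∀ {d} → Vec Carrier d → Vec Carrier d → Vec Carrier d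
  [] +ᵛ [] = []
  (x ∷ xs) +ᵛ (y ∷ ys) = (x + y) ∷ (xs +ᵛ ys)

  _*ᵛ_ : ∀ {d} → Vec Carrier d → Carrier → Vec Carrier d
  [] *ᵛ u = []
  (x ∷ xs) *ᵛ u = (x * u) ∷ (xs *ᵛ u)

  _·ᵛ_ : ∀ {d} → Carrier → Vec Carrier d → Vec Carrier d
  u ·ᵛ [] = []
  u ·ᵛ (x ∷ xs) = (u * x) ∷ (u ·ᵛ xs)

module Submission where

open import Defs
open import Data.Nat using (ℕ; _<_; _^_)
open import Data.Vec using (Vec)
open import Data.Vec.Relation.Unary.All using (All)
open import Data.Product using (∃; ∃₂; _×_)
import Data.Nat as ℕ

open import Data.Nat using (zero; suc; _≤_; z≤n)
import Data.Nat.Properties as ℕ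
open import Data.Nat.Tactic.RingSolver using (solve-∀)
open import Data.Bool using (true; false)
import Data.Bool as Bool
import Data.Fin as Fin
open import Data.List using (List; []; _∷_; map; length; allFin; cartesianProduct)
open import Data.List.Properties using (length-map; length-tabulate)
open import Data.Vec using ([]; _∷_)
open import Data.Vec.Properties using (≡-dec)
open import Data.Vec.Relation.Unary.All using ([]; _∷_)
open import Data.Product using (_,_; proj₁; proj₂)
open import Data.Sum using (_⊎_; inj₁; inj₂)
open import Data.Empty using (⊥; ⊥-elim)
open import Function.Bundles using (Inverse; _⇔_; mk⇔; Equivalence)
open import Function.Properties.Inverse using (Inverse⇒Injection)
open import Relation.Nullary using (¬_; Dec; yes; no; ¬?)
open import Relation.Nullary.Decidable using (via-injection; _×-dec_)
open import Relation.Unary using (Decidable)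
open import Relation.Binary.Definitions using (DecidableEquality)
open import Relation.Binary.PropositionalEquality
open import Algebra.Bundles using (CommutativeRing)
open import Algebra.Structures using (IsCommutativeRing)

-- Write α = (α₁ , α′) with α₁ ≠ 0. For v ∈ F^(d-1) the chart (s , t) ↦ s⁻¹ ((0 , v) + t α) on
-- F* × F is, for each fixed s, a bijection F^(d-1) × F ≅ F^d, so the slices S_v ⊆ F* × F pulled
-- back from B have total size (q - 1) |B|. If (a , c) and (s , t) lie in S_v and a (t - c) = s²,
-- i.e. (s , t) lies on the parabola with parameter a and vertex (0 , c), then
-- y = s⁻¹ ((0 , v) + c α) and u = s / a form a witness. Without witnesses the incidence count N of
-- S_v with the q (q - 1) parabolas vanishes on S_v itself, while Σ N = (q - 1) |S_v| and
-- Σ N² ≤ |S_v|² + 2 (q - 1) |S_v| (two points share at most one parabola unless they are mirror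
-- images at the same height); Cauchy–Schwarz on the complement of S_v gives |S_v|² ≤ 2 q (q - 1)².
-- Summing over v with Cauchy–Schwarz once more yields |B|² q ≤ 2 q^(2d) < 6 q^(2d); so not every
-- candidate fails, and as F^d × F is finite an exhaustive search produces a witness.

module NatArithmetic where

  open import Data.Nat using (_+_; _*_; _≤?_)
  open import Data.Nat.Properties

  *-square-cancel-≤ : ∀ {m n} → m * m ≤ n * n → m ≤ n
  *-square-cancel-≤ {m} {n} m²≤n² with m ≤? n
  ... | yes m≤n = m≤n
  ... | no  m≰n = ⊥-elim (<⇒≱ (*-mono-< (≰⇒> m≰n) (≰⇒> m≰n)) m²≤n²)

  private
    4*m*[m+o]≤[m+[m+o]]² : ∀ m o → 4 * (m * (m + o)) ≤ (m + (m + o)) * (m + (m + o))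
    4*m*[m+o]≤[m+[m+o]]² m o = subst₂ _≤_ (lhs m o) (rhs m o) (m≤m+n _ (o * o))
      where
      lhs : ∀ m o → 4 * (m * m) + 4 * (m * o) ≡ 4 * (m * (m + o))
      lhs = solve-∀
      rhs : ∀ m o → 4 * (m * m) + 4 * (m * o) + o * o ≡ (m + (m + o)) * (m + (m + o))
      rhs = solve-∀

  4*m*n≤[m+n]² : ∀ m n → 4 * (m * n) ≤ (m + n) * (m + n)
  4*m*n≤[m+n]² m n with ≤-total m n
  ... | inj₁ m≤n with o , refl ← m≤n⇒∃[o]m+o≡n m≤n = 4*m*[m+o]≤[m+[m+o]]² m o
  ... | inj₂ n≤m with o , refl ← m≤n⇒∃[o]m+o≡n n≤m =
    subst₂ _≤_ (cong (4 *_) (*-comm n m)) (cong (λ k → k * k) (+-comm n m)) (4*m*[m+o]≤[m+[m+o]]² n o)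

  -- With m = (1 + Q) Q - n: dividing by n gives Q² n ≤ m n + 2 m Q, so
  -- n² = (m + n) n - m n ≤ 2 m Q + Q n ≤ 2 Q (m + n).
  Q²n²≤m[n²+2Qn]⇒n²≤2[1+Q]Q² : ∀ Q n m → (Q * n) * (Q * n) ≤ m * (n * n + Q * (n * 2)) →
    m + n ≡ suc Q * Q → n * n ≤ 2 * suc Q * Q * Q
  Q²n²≤m[n²+2Qn]⇒n²≤2[1+Q]Q² Q zero      m _ _ = z≤n
  Q²n²≤m[n²+2Qn]⇒n²≤2[1+Q]Q² Q n@(suc _) m bound m+n≡[1+Q]Q = begin
    n * n                         ≤⟨ +-cancelˡ-≤ (m * n) _ _ mn+n²≤mn+[2mQ+Qn] ⟩
    2 * m * Q + Q * n             ≤⟨ +-monoʳ-≤ (2 * m * Q) (m≤n+m (Q * n) (Q * n)) ⟩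
    2 * m * Q + (Q * n + Q * n)   ≡⟨ regroup m n Q ⟩
    2 * Q * (m + n)               ≡⟨ cong (2 * Q *_) m+n≡[1+Q]Q ⟩
    2 * Q * (suc Q * Q)           ≡⟨ reorder Q ⟩
    2 * suc Q * Q * Q             ∎
    where
    open ≤-Reasoning
    regroup : ∀ m n Q → 2 * m * Q + (Q * n + Q * n) ≡ 2 * Q * (m + n)
    regroup = solve-∀
    reorder : ∀ Q → 2 * Q * (suc Q * Q) ≡ 2 * suc Q * Q * Q
    reorder = solve-∀
    Q²n≤mn+2mQ : Q * Q * n ≤ m * n + 2 * m * Q
    Q²n≤mn+2mQ = *-cancelʳ-≤ _ _ n (subst₂ _≤_ (lhs Q n) (rhs m n Q) bound)
      where
      lhs : ∀ Q n → (Q * n) * (Q * n) ≡ (Q * Q * n) * n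
      lhs = solve-∀
      rhs : ∀ m n Q → m * (n * n + Q * (n * 2)) ≡ (m * n + 2 * m * Q) * n
      rhs = solve-∀
    mn+n²≤mn+[2mQ+Qn] : m * n + n * n ≤ m * n + (2 * m * Q + Q * n)
    mn+n²≤mn+[2mQ+Qn] = begin
      m * n + n * n                  ≡⟨ *-distribʳ-+ n m n ⟨
      (m + n) * n                    ≡⟨ cong (_* n) m+n≡[1+Q]Q ⟩
      (suc Q * Q) * n                ≡⟨ expand Q n ⟩
      Q * Q * n + Q * n              ≤⟨ +-monoˡ-≤ (Q * n) Q²n≤mn+2mQ ⟩
      (m * n + 2 * m * Q) + Q * n    ≡⟨ +-assoc (m * n) _ _ ⟩
      m * n + (2 * m * Q + Q * n)    ∎
      where
      expand : ∀ Q n → (suc Q * Q) * n ≡ Q * Q * n + Q * n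
      expand = solve-∀

  [Qb]²≤P[2[1+Q]Q²]⇒b²[1+Q]≤2P[1+Q]² : ∀ Q b P → 1 ≤ Q → (Q * b) * (Q * b) ≤ P * (2 * suc Q * Q * Q) →
    b * b * suc Q ≤ 2 * (P * (suc Q * suc Q))
  [Qb]²≤P[2[1+Q]Q²]⇒b²[1+Q]≤2P[1+Q]² Q@(suc _) b P _ bound =
    subst (b * b * suc Q ≤_) (regroup P Q) (*-monoˡ-≤ (suc Q) b²≤2P[1+Q])
    where
    square-product : ∀ Q b → (Q * b) * (Q * b) ≡ (Q * Q) * (b * b)
    square-product = solve-∀
    reorder : ∀ P Q → P * (2 * suc Q * Q * Q) ≡ (Q * Q) * (P * 2 * suc Q)
    reorder = solve-∀
    regroup : ∀ P Q → P * 2 * suc Q * suc Q ≡ 2 * (P * (suc Q * suc Q))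
    regroup = solve-∀
    b²≤2P[1+Q] : b * b ≤ P * 2 * suc Q
    b²≤2P[1+Q] = *-cancelˡ-≤ (Q * Q) (subst₂ _≤_ (square-product Q b) (reorder P Q) bound)

  m^[2[1+n]]≡m^n*m^n*[m*m] : ∀ m n → m ^ (2 * suc n) ≡ (m ^ n * m ^ n) * (m * m)
  m^[2[1+n]]≡m^n*m^n*[m*m] m n = begin
    m ^ (suc n + (suc n + 0))        ≡⟨ cong (λ k → m ^ (suc n + k)) (+-identityʳ (suc n)) ⟩
    m ^ (suc n + suc n)              ≡⟨ ^-distribˡ-+-* m (suc n) (suc n) ⟩
    (m * m ^ n) * (m * m ^ n)        ≡⟨ regroup m (m ^ n) ⟩
    (m ^ n * m ^ n) * (m * m)        ∎
    where
    open ≡-Reasoning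
    regroup : ∀ m k → (m * k) * (m * k) ≡ (k * k) * (m * m)
    regroup = solve-∀

open NatArithmetic

module FiniteSums where

  open import Level using (Level)
  open import Data.Nat using (_+_; _*_; s≤s)
  open import Data.Nat.Properties
  open import Data.List using (_++_; concatMap; filter)
  open import Data.List.Properties using (map-tabulate)
  import Data.Fin.Properties as Fin
  open import Data.List.Membership.Propositional using (_∈_; lose)
  open import Data.List.Relation.Unary.Any using (here; there; any?; satisfied)

  private variable
    a b p q : Level
    A : Set a
    B : Set b

  ∑ : List A → (A → ℕ) → ℕ
  ∑ []       f = 0
  ∑ (x ∷ xs) f = f x + ∑ xs f

  syntax ∑ xs (λ x → e) = ∑[ x ← xs ] e

  ∑-cong : ∀ (xs : List A) {f g : A → ℕ} → (∀ x → f x ≡ g x) → ∑ xs f ≡ ∑ xs g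
  ∑-cong []       f≗g = refl
  ∑-cong (x ∷ xs) f≗g = cong₂ _+_ (f≗g x) (∑-cong xs f≗g)

  ∑-mono-≤ : ∀ (xs : List A) {f g : A → ℕ} → (∀ x → f x ≤ g x) → ∑ xs f ≤ ∑ xs g
  ∑-mono-≤ []       f≤g = z≤n
  ∑-mono-≤ (x ∷ xs) f≤g = +-mono-≤ (f≤g x) (∑-mono-≤ xs f≤g)

  ∑-zero : ∀ (xs : List A) {f : A → ℕ} → (∀ x → f x ≡ 0) → ∑ xs f ≡ 0
  ∑-zero []       f≗0 = refl
  ∑-zero (x ∷ xs) f≗0 = cong₂ _+_ (f≗0 x) (∑-zero xs f≗0)

  ∑-const : ∀ (xs : List A) c → ∑[ _ ← xs ] c ≡ length xs * c
  ∑-const []       c = refl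
  ∑-const (x ∷ xs) c = cong (c +_) (∑-const xs c)

  ∑-distrib-+ : ∀ (xs : List A) (f g : A → ℕ) → ∑[ x ← xs ] (f x + g x) ≡ ∑ xs f + ∑ xs g
  ∑-distrib-+ []       f g = refl
  ∑-distrib-+ (x ∷ xs) f g = trans (cong (f x + g x +_) (∑-distrib-+ xs f g))
                                   (+-+-interchange (f x) (g x) (∑ xs f) (∑ xs g))
    where
    +-+-interchange : ∀ a b c d → (a + b) + (c + d) ≡ (a + c) + (b + d)
    +-+-interchange = solve-∀

  ∑-*ˡ : ∀ (xs : List A) c (f : A → ℕ) → ∑[ x ← xs ] (c * f x) ≡ c * ∑ xs f
  ∑-*ˡ []       c f = sym (*-zeroʳ c)
  ∑-*ˡ (x ∷ xs) c f = trans (cong (c * f x +_) (∑-*ˡ xs c f)) (sym (*-distribˡ-+ c (f x) (∑ xs f)))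

  ∑-*ʳ : ∀ (xs : List A) c (f : A → ℕ) → ∑[ x ← xs ] (f x * c) ≡ ∑ xs f * c
  ∑-*ʳ xs c f = trans (∑-cong xs (λ x → *-comm (f x) c)) (trans (∑-*ˡ xs c f) (*-comm c (∑ xs f)))

  ∑-++ : ∀ (xs ys : List A) (f : A → ℕ) → ∑ (xs ++ ys) f ≡ ∑ xs f + ∑ ys f
  ∑-++ []       ys f = refl
  ∑-++ (x ∷ xs) ys f = trans (cong (f x +_) (∑-++ xs ys f)) (sym (+-assoc (f x) (∑ xs f) (∑ ys f)))

  ∑-map : ∀ (g : A → B) (xs : List A) (f : B → ℕ) → ∑ (map g xs) f ≡ ∑[ x ← xs ] f (g x)
  ∑-map g []       f = refl
  ∑-map g (x ∷ xs) f = cong (f (g x) +_) (∑-map g xs f)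

  ∑-concatMap : ∀ (g : A → List B) (xs : List A) (f : B → ℕ) →
    ∑ (concatMap g xs) f ≡ ∑[ x ← xs ] ∑ (g x) f
  ∑-concatMap g []       f = refl
  ∑-concatMap g (x ∷ xs) f = trans (∑-++ (g x) (concatMap g xs) f) (cong (∑ (g x) f +_) (∑-concatMap g xs f))

  ∑-cartesianProduct : ∀ (xs : List A) (ys : List B) (f : A × B → ℕ) →
    ∑ (cartesianProduct xs ys) f ≡ ∑[ x ← xs ] ∑[ y ← ys ] f (x , y)
  ∑-cartesianProduct []       ys f = refl
  ∑-cartesianProduct (x ∷ xs) ys f = trans (∑-++ (map (x ,_) ys) (cartesianProduct xs ys) f)
    (cong₂ _+_ (∑-map (x ,_) ys f) (∑-cartesianProduct xs ys f))

  ∑-comm : ∀ (xs : List A) (ys : List B) (f : A → B → ℕ) →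
    ∑[ x ← xs ] ∑[ y ← ys ] f x y ≡ ∑[ y ← ys ] ∑[ x ← xs ] f x y
  ∑-comm []       ys f = sym (∑-zero ys (λ _ → refl))
  ∑-comm (x ∷ xs) ys f = trans (cong (∑ ys (f x) +_) (∑-comm xs ys f))
                               (sym (∑-distrib-+ ys (f x) (λ y → ∑[ x ← xs ] f x y)))

  ∑-*-∑ : ∀ (xs : List A) (ys : List B) (f : A → ℕ) (g : B → ℕ) →
    ∑ xs f * ∑ ys g ≡ ∑[ x ← xs ] ∑[ y ← ys ] (f x * g y)
  ∑-*-∑ xs ys f g = trans (sym (∑-*ʳ xs (∑ ys g) f)) (∑-cong xs (λ x → sym (∑-*ˡ ys (f x) g)))

  𝟙 : {P : Set p} → Dec P → ℕ
  𝟙 (yes _) = 1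
  𝟙 (no _)  = 0

  𝟙-≤1 : {P : Set p} (P? : Dec P) → 𝟙 P? ≤ 1
  𝟙-≤1 (yes _) = s≤s z≤n
  𝟙-≤1 (no _)  = z≤n

  𝟙-yes : {P : Set p} (P? : Dec P) → P → 𝟙 P? ≡ 1
  𝟙-yes (yes _)  _ = refl
  𝟙-yes (no ¬p)  p = ⊥-elim (¬p p)

  𝟙-mono : {P : Set p} {Q : Set q} (P? : Dec P) (Q? : Dec Q) → (P → Q) → 𝟙 P? ≤ 𝟙 Q?
  𝟙-mono (yes p) (yes _) _   = ≤-refl
  𝟙-mono (yes p) (no ¬q) P⇒Q = ⊥-elim (¬q (P⇒Q p))
  𝟙-mono (no _)  _       _   = z≤n

  𝟙-cong : {P : Set p} {Q : Set q} (P? : Dec P) (Q? : Dec Q) → (P → Q) → (Q → P) → 𝟙 P? ≡ 𝟙 Q?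
  𝟙-cong P? Q? P⇒Q Q⇒P = ≤-antisym (𝟙-mono P? Q? P⇒Q) (𝟙-mono Q? P? Q⇒P)

  𝟙-idem : {P : Set p} (P? : Dec P) → 𝟙 P? * 𝟙 P? ≡ 𝟙 P?
  𝟙-idem (yes _) = refl
  𝟙-idem (no _)  = refl

  𝟙-× : {P : Set p} {Q : Set q} (P? : Dec P) (Q? : Dec Q) → 𝟙 (P? ×-dec Q?) ≡ 𝟙 P? * 𝟙 Q?
  𝟙-× (yes _) (yes _) = refl
  𝟙-× (yes _) (no _)  = refl
  𝟙-× (no _)  _       = refl

  length-filter≡∑𝟙 : {P : A → Set p} (P? : Decidable P) (xs : List A) →
    length (filter P? xs) ≡ ∑[ x ← xs ] 𝟙 (P? x)
  length-filter≡∑𝟙 P? []       = refl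
  length-filter≡∑𝟙 P? (x ∷ xs) with P? x
  ... | yes _ = cong suc (length-filter≡∑𝟙 P? xs)
  ... | no _  = length-filter≡∑𝟙 P? xs

  cauchy-schwarz : ∀ (xs : List A) (f g : A → ℕ) →
    ∑[ x ← xs ] (f x * g x) * ∑[ x ← xs ] (f x * g x) ≤
    ∑[ x ← xs ] (f x * f x) * ∑[ x ← xs ] (g x * g x)
  cauchy-schwarz []       f g = z≤n
  cauchy-schwarz (x ∷ xs) f g = step (f x) (g x) (cauchy-schwarz xs f g)
    where
    step : ∀ {C S T} m n → C * C ≤ S * T → (m * n + C) * (m * n + C) ≤ (m * m + S) * (n * n + T)
    step {C} {S} {T} m n C²≤ST = subst₂ _≤_ (sym (expandˡ m n C)) (sym (expandʳ m n S T))
        (+-mono-≤ (+-monoʳ-≤ (m * n * (m * n)) cross) C²≤ST)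
      where
      expandˡ : ∀ m n C → (m * n + C) * (m * n + C) ≡ m * n * (m * n) + 2 * (m * n * C) + C * C
      expandˡ = solve-∀
      expandʳ : ∀ m n S T → (m * m + S) * (n * n + T) ≡ m * n * (m * n) + (S * (n * n) + m * m * T) + S * T
      expandʳ = solve-∀
      square-cross : ∀ m n C → (2 * (m * n * C)) * (2 * (m * n * C)) ≡ 4 * (m * m * (n * n) * (C * C))
      square-cross = solve-∀
      regroup : ∀ m n S T → 4 * (m * m * (n * n) * (S * T)) ≡ 4 * (S * (n * n) * (m * m * T))
      regroup = solve-∀
      -- the cross term is handled by AM-GM: (2mnC)² ≤ 4 (Sn²)(m²T) ≤ (Sn² + m²T)²
      cross : 2 * (m * n * C) ≤ S * (n * n) + m * m * T
      cross = *-square-cancel-≤ (begin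
        (2 * (m * n * C)) * (2 * (m * n * C))  ≡⟨ square-cross m n C ⟩
        4 * (m * m * (n * n) * (C * C))        ≤⟨ *-monoʳ-≤ 4 (*-monoʳ-≤ (m * m * (n * n)) C²≤ST) ⟩
        4 * (m * m * (n * n) * (S * T))        ≡⟨ regroup m n S T ⟩
        4 * (S * (n * n) * (m * m * T))        ≤⟨ 4*m*n≤[m+n]² (S * (n * n)) (m * m * T) ⟩
        (S * (n * n) + m * m * T) * (S * (n * n) + m * m * T) ∎)
        where open ≤-Reasoning

  ∑-square-≤ : ∀ (xs : List A) (f : A → ℕ) {K} → (∀ x → f x * f x ≤ K) →
    ∑ xs f * ∑ xs f ≤ (length xs * length xs) * K
  ∑-square-≤ xs f {K} f²≤K = begin
    ∑ xs f * ∑ xs f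
      ≡⟨ cong (λ s → s * s) (∑-cong xs (λ x → sym (*-identityʳ (f x)))) ⟩
    ∑[ x ← xs ] (f x * 1) * ∑[ x ← xs ] (f x * 1)
      ≤⟨ cauchy-schwarz xs f (λ _ → 1) ⟩
    ∑[ x ← xs ] (f x * f x) * ∑[ _ ← xs ] 1
      ≤⟨ *-mono-≤ (∑-mono-≤ xs f²≤K) (≤-reflexive (∑-const xs 1)) ⟩
    ∑[ _ ← xs ] K * (length xs * 1)
      ≡⟨ cong (_* (length xs * 1)) (∑-const xs K) ⟩
    length xs * K * (length xs * 1)
      ≡⟨ regroup (length xs) K ⟩
    (length xs * length xs) * K ∎
    where
    open ≤-Reasoning
    regroup : ∀ l K → l * K * (l * 1) ≡ (l * l) * K
    regroup = solve-∀

  ∈⇒≤∑ : ∀ {z} {xs : List A} (f : A → ℕ) → z ∈ xs → f z ≤ ∑ xs f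
  ∈⇒≤∑ f (here refl)  = m≤m+n _ _
  ∈⇒≤∑ f (there z∈xs) = ≤-trans (∈⇒≤∑ f z∈xs) (m≤n+m _ _)

  IsEnumeration : {A : Set a} → DecidableEquality A → List A → Set a
  IsEnumeration _≟_ xs = ∀ z → ∑[ x ← xs ] 𝟙 (x ≟ z) ≡ 1

  module Enumeration {A : Set a} (_≟_ : DecidableEquality A) (xs : List A)
                     (xs-enum : IsEnumeration _≟_ xs) where

    ∑-select : ∀ z (f : A → ℕ) → ∑[ x ← xs ] (𝟙 (x ≟ z) * f x) ≡ f z
    ∑-select z f = begin
      ∑[ x ← xs ] (𝟙 (x ≟ z) * f x)  ≡⟨ ∑-cong xs at-z ⟩
      ∑[ x ← xs ] (𝟙 (x ≟ z) * f z)  ≡⟨ ∑-*ʳ xs (f z) (λ x → 𝟙 (x ≟ z)) ⟩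
      ∑[ x ← xs ] 𝟙 (x ≟ z) * f z    ≡⟨ cong (_* f z) (xs-enum z) ⟩
      1 * f z                         ≡⟨ *-identityˡ (f z) ⟩
      f z                             ∎
      where
      open ≡-Reasoning
      at-z : ∀ x → 𝟙 (x ≟ z) * f x ≡ 𝟙 (x ≟ z) * f z
      at-z x with x ≟ z
      ... | yes refl = refl
      ... | no _     = refl

    ∑-select-unique : {P : A → Set p} (P? : Decidable P) (z : A) → (∀ x → P x ⇔ x ≡ z) →
      ∀ (f : A → ℕ) → ∑[ x ← xs ] (𝟙 (P? x) * f x) ≡ f z
    ∑-select-unique P? z P⇔≡z f = trans
      (∑-cong xs (λ x → cong (_* f x) (𝟙-cong (P? x) (x ≟ z) (to (P⇔≡z x)) (from (P⇔≡z x)))))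
      (∑-select z f)
      where open Equivalence

    ∑-𝟙-unique : {P : A → Set p} (P? : Decidable P) (z : A) → (∀ x → P x ⇔ x ≡ z) →
      ∑[ x ← xs ] 𝟙 (P? x) ≡ 1
    ∑-𝟙-unique P? z P⇔≡z = trans (∑-cong xs (λ x → sym (*-identityʳ (𝟙 (P? x)))))
                                 (∑-select-unique P? z P⇔≡z (λ _ → 1))

    ∑-reindex : (σ τ : A → A) → (∀ x → τ (σ x) ≡ x) → (∀ y → σ (τ y) ≡ y) →
      ∀ (f : A → ℕ) → ∑[ x ← xs ] f (σ x) ≡ ∑ xs f
    ∑-reindex σ τ τσ≗id στ≗id f = begin
      ∑[ x ← xs ] f (σ x)
        ≡⟨ ∑-cong xs (λ x → sym (∑-select-unique (_≟ σ x) (σ x) (λ _ → mk⇔ (λ e → e) (λ e → e)) f)) ⟩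
      ∑[ x ← xs ] ∑[ y ← xs ] (𝟙 (y ≟ σ x) * f y)
        ≡⟨ ∑-comm xs xs _ ⟩
      ∑[ y ← xs ] ∑[ x ← xs ] (𝟙 (y ≟ σ x) * f y)
        ≡⟨ ∑-cong xs (λ y → ∑-*ʳ xs (f y) _) ⟩
      ∑[ y ← xs ] (∑[ x ← xs ] 𝟙 (y ≟ σ x) * f y)
        ≡⟨ ∑-cong xs (λ y → cong (_* f y) (∑-𝟙-unique (λ x → y ≟ σ x) (τ y) (preimage y))) ⟩
      ∑[ y ← xs ] (1 * f y)
        ≡⟨ ∑-cong xs (λ y → *-identityˡ (f y)) ⟩
      ∑ xs f ∎
      where
      open ≡-Reasoning
      preimage : ∀ y x → (y ≡ σ x) ⇔ (x ≡ τ y)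
      preimage y x = mk⇔ (λ y≡σx → trans (sym (τσ≗id x)) (cong τ (sym y≡σx)))
                         (λ x≡τy → sym (trans (cong σ x≡τy) (στ≗id y)))

    ∈-enumeration : ∀ z → z ∈ xs
    ∈-enumeration z = go xs (xs-enum z)
      where
      go : ∀ ys → ∑[ y ← ys ] 𝟙 (y ≟ z) ≡ 1 → z ∈ ys
      go []       ()
      go (y ∷ ys) count with y ≟ z
      ... | yes y≡z = here (sym y≡z)
      ... | no _    = there (go ys count)

    ∃? : {P : A → Set p} → Decidable P → Dec (∃ P)
    ∃? P? with any? P? xs
    ... | yes any = yes (satisfied any)
    ... | no ¬any = no (λ (z , pz) → ¬any (lose (∈-enumeration z) pz))

  allFin-enumeration : ∀ n → IsEnumeration Fin._≟_ (allFin n)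
  allFin-enumeration (suc n) z rewrite sym (map-tabulate {n = n} (λ i → i) Fin.suc) =
    trans (cong (𝟙 (Fin.zero Fin.≟ z) +_) (∑-map Fin.suc (allFin n) (λ i → 𝟙 (i Fin.≟ z)))) (count z)
    where
    count : ∀ z → 𝟙 (Fin.zero Fin.≟ z) + ∑[ i ← allFin n ] 𝟙 (Fin.suc i Fin.≟ z) ≡ 1
    count Fin.zero    = cong suc (∑-zero (allFin n) (λ _ → refl))
    count (Fin.suc z) = trans (∑-cong (allFin n) (λ i → 𝟙-cong (Fin.suc i Fin.≟ Fin.suc z) (i Fin.≟ z)
                                                                Fin.suc-injective (cong Fin.suc)))
                              (allFin-enumeration n z)

open FiniteSums

module FiniteFieldProperties (F : FiniteField) where

  open FiniteField F public
  open IsCommutativeRing isCommutativeRing public hiding (refl; sym; trans)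

  commutativeRing : CommutativeRing _ _
  commutativeRing = record { isCommutativeRing = isCommutativeRing }

  open CommutativeRing commutativeRing using (+-group; +-abelianGroup; ring)
  open import Algebra.Properties.Group +-group public using (x∙y⁻¹≈ε⇒x≈y)
  open import Algebra.Properties.Group +-group using (inverseˡ-unique; ⁻¹-involutive)
  open import Algebra.Properties.AbelianGroup +-abelianGroup using (⁻¹-∙-comm)
  open import Algebra.Properties.Ring ring using ([y-z]x≈yx-zx)

  infix 4 _≟_ _≟ᵛ_
  _≟_ : DecidableEquality Carrier
  _≟_ = via-injection (Inverse⇒Injection enum) Fin._≟_

  _≟ᵛ_ : ∀ {d} → DecidableEquality (Vec Carrier d)
  _≟ᵛ_ = ≡-dec _≟_

  elements-enumeration : IsEnumeration _≟_ elements
  elements-enumeration z = begin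
    ∑[ x ← elements ] 𝟙 (x ≟ z)                             ≡⟨ ∑-map (Inverse.from enum) (allFin size) _ ⟩
    ∑[ i ← allFin size ] 𝟙 (Inverse.from enum i ≟ z)        ≡⟨ ∑-cong (allFin size) (λ i → 𝟙-cong _ _ to-≡ from-≡) ⟩
    ∑[ i ← allFin size ] 𝟙 (i Fin.≟ Inverse.to enum z)      ≡⟨ allFin-enumeration size (Inverse.to enum z) ⟩
    1                                                        ∎
    where
    open ≡-Reasoning
    to-≡ : ∀ {i} → Inverse.from enum i ≡ z → i ≡ Inverse.to enum z
    to-≡ {i} e = trans (sym (Inverse.strictlyInverseˡ enum i)) (cong (Inverse.to enum) e)
    from-≡ : ∀ {i} → i ≡ Inverse.to enum z → Inverse.from enum i ≡ z
    from-≡ e = trans (cong (Inverse.from enum) e) (Inverse.strictlyInverseʳ enum z)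

  length-elements : length elements ≡ card
  length-elements = trans (length-map (Inverse.from enum) (allFin size)) (length-tabulate (λ i → i))

  ∑-allVecs-suc : ∀ d (f : Vec Carrier (suc d) → ℕ) →
    ∑ (allVecs (suc d)) f ≡ ∑[ x ← elements ] ∑[ v ← allVecs d ] f (x ∷ v)
  ∑-allVecs-suc d f = trans (∑-concatMap (λ x → map (x ∷_) (allVecs d)) elements f)
                            (∑-cong elements (λ x → ∑-map (x ∷_) (allVecs d) f))

  module Elements = Enumeration _≟_ elements elements-enumeration

  allVecs-enumeration : ∀ d → IsEnumeration _≟ᵛ_ (allVecs d)
  allVecs-enumeration zero    []       = refl
  allVecs-enumeration (suc d) (z ∷ zs) = begin
    ∑[ v ← allVecs (suc d) ] 𝟙 (v ≟ᵛ z ∷ zs)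
      ≡⟨ ∑-allVecs-suc d _ ⟩
    ∑[ x ← elements ] ∑[ v ← allVecs d ] 𝟙 (x ∷ v ≟ᵛ z ∷ zs)
      ≡⟨ ∑-cong elements (λ x → ∑-cong (allVecs d) (λ v → split x v)) ⟩
    ∑[ x ← elements ] ∑[ v ← allVecs d ] (𝟙 (x ≟ z) ℕ.* 𝟙 (v ≟ᵛ zs))
      ≡⟨ ∑-cong elements (λ x → ∑-*ˡ (allVecs d) (𝟙 (x ≟ z)) _) ⟩
    ∑[ x ← elements ] (𝟙 (x ≟ z) ℕ.* ∑[ v ← allVecs d ] 𝟙 (v ≟ᵛ zs))
      ≡⟨ Elements.∑-select z _ ⟩
    ∑[ v ← allVecs d ] 𝟙 (v ≟ᵛ zs)
      ≡⟨ allVecs-enumeration d zs ⟩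
    1 ∎
    where
    open ≡-Reasoning
    split : ∀ x v → 𝟙 (x ∷ v ≟ᵛ z ∷ zs) ≡ 𝟙 (x ≟ z) ℕ.* 𝟙 (v ≟ᵛ zs)
    split x v = trans (𝟙-cong (x ∷ v ≟ᵛ z ∷ zs) ((x ≟ z) ×-dec (v ≟ᵛ zs))
                              (λ { refl → refl , refl }) (λ { (refl , refl) → refl }))
                      (𝟙-× (x ≟ z) (v ≟ᵛ zs))

  module Vectors {d} = Enumeration _≟ᵛ_ (allVecs d) (allVecs-enumeration d)

  length-allVecs : ∀ d → length (allVecs d) ≡ card ℕ.^ d
  length-allVecs zero    = refl
  length-allVecs (suc d) = begin
    length (allVecs (suc d))                           ≡⟨ count (allVecs (suc d)) ⟨
    ∑[ _ ← allVecs (suc d) ] 1                         ≡⟨ ∑-allVecs-suc d _ ⟩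
    ∑[ _ ← elements ] ∑[ _ ← allVecs d ] 1             ≡⟨ ∑-cong elements (λ _ → count (allVecs d)) ⟩
    ∑[ _ ← elements ] length (allVecs d)               ≡⟨ ∑-const elements _ ⟩
    length elements ℕ.* length (allVecs d)             ≡⟨ cong₂ ℕ._*_ length-elements (length-allVecs d) ⟩
    card ℕ.* card ℕ.^ d                                ∎
    where
    open ≡-Reasoning
    count : ∀ {A : Set} (xs : List A) → ∑[ _ ← xs ] 1 ≡ length xs
    count xs = trans (∑-const xs 1) (ℕ.*-identityʳ (length xs))

  1≢0 : Nonzero 1#
  1≢0 1≡0 = 0≢1 (sym 1≡0)

  𝟙* : Carrier → ℕ
  𝟙* a = 𝟙 (¬? (a ≟ 0#))

  𝟙*-cong : ∀ a {m n} → (Nonzero a → m ≡ n) → 𝟙* a ℕ.* m ≡ 𝟙* a ℕ.* n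
  𝟙*-cong a m≡n with a ≟ 0#
  ... | yes _   = refl
  ... | no a≢0  = cong (1 ℕ.*_) (m≡n a≢0)

  ∣F*∣ : ℕ
  ∣F*∣ = ∑ elements 𝟙*

  card≡1+∣F*∣ : card ≡ suc ∣F*∣
  card≡1+∣F*∣ = begin
    card                                                 ≡⟨ length-elements ⟨
    length elements                                      ≡⟨ trans (∑-const elements 1) (ℕ.*-identityʳ _) ⟨
    ∑[ a ← elements ] 1                                  ≡⟨ ∑-cong elements split ⟩
    ∑[ a ← elements ] (𝟙 (a ≟ 0#) ℕ.+ 𝟙* a)             ≡⟨ ∑-distrib-+ elements _ 𝟙* ⟩
    ∑[ a ← elements ] 𝟙 (a ≟ 0#) ℕ.+ ∣F*∣               ≡⟨ cong (ℕ._+ ∣F*∣) (elements-enumeration 0#) ⟩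
    suc ∣F*∣                                             ∎
    where
    open ≡-Reasoning
    split : ∀ a → 1 ≡ 𝟙 (a ≟ 0#) ℕ.+ 𝟙* a
    split a with a ≟ 0#
    ... | yes _ = refl
    ... | no _  = refl

  1≤∣F*∣ : 1 ≤ ∣F*∣
  1≤∣F*∣ = subst (_≤ ∣F*∣) (𝟙-yes (¬? (1# ≟ 0#)) 1≢0) (∈⇒≤∑ 𝟙* (Elements.∈-enumeration 1#))

  infix 30 _⁻¹
  -- 0# ⁻¹ is a junk value (0#); every lemma about _⁻¹ assumes a nonzero argument.
  _⁻¹ : Carrier → Carrier
  x ⁻¹ with x ≟ 0#
  ... | yes _   = 0#
  ... | no x≢0  = proj₁ (inverse x x≢0)

  x*x⁻¹≡1 : ∀ {x} → Nonzero x → x * x ⁻¹ ≡ 1#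
  x*x⁻¹≡1 {x} x≢0 with x ≟ 0#
  ... | yes x≡0 = ⊥-elim (x≢0 x≡0)
  ... | no x≢0′ = proj₂ (inverse x x≢0′)

  x⁻¹*x≡1 : ∀ {x} → Nonzero x → x ⁻¹ * x ≡ 1#
  x⁻¹*x≡1 {x} x≢0 = trans (*-comm (x ⁻¹) x) (x*x⁻¹≡1 x≢0)

  x⁻¹*[x*y]≡y : ∀ {x} → Nonzero x → ∀ y → x ⁻¹ * (x * y) ≡ y
  x⁻¹*[x*y]≡y {x} x≢0 y = begin
    x ⁻¹ * (x * y)  ≡⟨ *-assoc (x ⁻¹) x y ⟨
    x ⁻¹ * x * y    ≡⟨ cong (_* y) (x⁻¹*x≡1 x≢0) ⟩
    1# * y          ≡⟨ *-identityˡ y ⟩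
    y               ∎
    where open ≡-Reasoning

  x*[x⁻¹*y]≡y : ∀ {x} → Nonzero x → ∀ y → x * (x ⁻¹ * y) ≡ y
  x*[x⁻¹*y]≡y {x} x≢0 y = begin
    x * (x ⁻¹ * y)  ≡⟨ *-assoc x (x ⁻¹) y ⟨
    x * x ⁻¹ * y    ≡⟨ cong (_* y) (x*x⁻¹≡1 x≢0) ⟩
    1# * y          ≡⟨ *-identityˡ y ⟩
    y               ∎
    where open ≡-Reasoning

  x*y*y⁻¹≡x : ∀ {y} → Nonzero y → ∀ x → x * y * y ⁻¹ ≡ x
  x*y*y⁻¹≡x {y} y≢0 x = trans (*-assoc x y (y ⁻¹)) (trans (cong (x *_) (x*x⁻¹≡1 y≢0)) (*-identityʳ x))

  x*y⁻¹*y≡x : ∀ {y} → Nonzero y → ∀ x → x * y ⁻¹ * y ≡ x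
  x*y⁻¹*y≡x {y} y≢0 x = trans (*-assoc x (y ⁻¹) y) (trans (cong (x *_) (x⁻¹*x≡1 y≢0)) (*-identityʳ x))

  x*y≡0⇒x≡0⊎y≡0 : ∀ {x y} → x * y ≡ 0# → x ≡ 0# ⊎ y ≡ 0#
  x*y≡0⇒x≡0⊎y≡0 {x} {y} xy≡0 with x ≟ 0#
  ... | yes x≡0 = inj₁ x≡0
  ... | no x≢0  = inj₂ (trans (sym (x⁻¹*[x*y]≡y x≢0 y)) (trans (cong (x ⁻¹ *_) xy≡0) (zeroʳ (x ⁻¹))))

  *-nonzero : ∀ {x y} → Nonzero x → Nonzero y → Nonzero (x * y)
  *-nonzero x≢0 y≢0 xy≡0 with x*y≡0⇒x≡0⊎y≡0 xy≡0
  ... | inj₁ x≡0 = x≢0 x≡0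
  ... | inj₂ y≡0 = y≢0 y≡0

  ⁻¹-nonzero : ∀ {x} → Nonzero x → Nonzero (x ⁻¹)
  ⁻¹-nonzero {x} x≢0 x⁻¹≡0 = 1≢0 (trans (sym (x*x⁻¹≡1 x≢0)) (trans (cong (x *_) x⁻¹≡0) (zeroʳ x)))

  x*x≡y*y⇒x≡y⊎x≡-y : ∀ {x y} → x * x ≡ y * y → x ≡ y ⊎ x ≡ - y
  x*x≡y*y⇒x≡y⊎x≡-y {x} {y} x²≡y² with x*y≡0⇒x≡0⊎y≡0 [x-y][x+y]≡0
    where
    [x-y][x+y]≡0 : (x - y) * (x + y) ≡ 0#
    [x-y][x+y]≡0 = begin
      (x - y) * (x + y)                    ≡⟨ distribˡ (x - y) x y ⟩
      (x - y) * x + (x - y) * y            ≡⟨ cong₂ _+_ ([y-z]x≈yx-zx x x y) ([y-z]x≈yx-zx y x y) ⟩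
      (x * x - y * x) + (x * y - y * y)    ≡⟨ cong (λ z → (x * x - z) + (x * y - y * y)) (*-comm y x) ⟩
      (x * x - x * y) + (x * y - y * y)    ≡⟨ +-assoc (x * x) (- (x * y)) (x * y - y * y) ⟩
      x * x + (- (x * y) + (x * y - y * y)) ≡⟨ cong (x * x +_) (+-assoc (- (x * y)) (x * y) (- (y * y))) ⟨
      x * x + ((- (x * y) + x * y) - y * y) ≡⟨ cong (λ z → x * x + (z - y * y)) (-‿inverseˡ (x * y)) ⟩
      x * x + (0# - y * y)                 ≡⟨ cong (x * x +_) (+-identityˡ (- (y * y))) ⟩
      x * x - y * y                        ≡⟨ cong (_- y * y) x²≡y² ⟩
      y * y - y * y                        ≡⟨ -‿inverseʳ (y * y) ⟩
      0#                                   ∎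
      where open ≡-Reasoning
  ... | inj₁ x-y≡0 = inj₁ (x∙y⁻¹≈ε⇒x≈y x y x-y≡0)
  ... | inj₂ x+y≡0 = inj₂ (inverseˡ-unique x y x+y≡0)

  x+y-y≡x : ∀ x y → x + y - y ≡ x
  x+y-y≡x x y = trans (+-assoc x y (- y)) (trans (cong (x +_) (-‿inverseʳ y)) (+-identityʳ x))

  x-y+y≡x : ∀ x y → x - y + y ≡ x
  x-y+y≡x x y = trans (+-assoc x (- y) y) (trans (cong (x +_) (-‿inverseˡ y)) (+-identityʳ x))

  x-[y-z]≡x-y+z : ∀ x y z → x - (y - z) ≡ x - y + z
  x-[y-z]≡x-y+z x y z = begin
    x + - (y + - z)   ≡⟨ cong (x +_) (⁻¹-∙-comm y (- z)) ⟨
    x + (- y + - - z) ≡⟨ cong (λ w → x + (- y + w)) (⁻¹-involutive z) ⟩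
    x + (- y + z)     ≡⟨ +-assoc x (- y) z ⟨
    x - y + z         ∎
    where open ≡-Reasoning

  a*[t-c]≡k⇔c≡t-k*a⁻¹ : ∀ {a t c k} → Nonzero a → (a * (t - c) ≡ k) ⇔ (c ≡ t - k * a ⁻¹)
  a*[t-c]≡k⇔c≡t-k*a⁻¹ {a} {t} {c} {k} a≢0 = mk⇔ solved checked
    where
    open ≡-Reasoning
    t-[t-c]≡c : t - (t - c) ≡ c
    t-[t-c]≡c = trans (x-[y-z]≡x-y+z t t c) (trans (cong (_+ c) (-‿inverseʳ t)) (+-identityˡ c))
    solved : a * (t - c) ≡ k → c ≡ t - k * a ⁻¹
    solved a[t-c]≡k = begin
      c                      ≡⟨ t-[t-c]≡c ⟨
      t - (t - c)            ≡⟨ cong (λ w → t - w) (x⁻¹*[x*y]≡y a≢0 (t - c)) ⟨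
      t - a ⁻¹ * (a * (t - c)) ≡⟨ cong (λ w → t - a ⁻¹ * w) a[t-c]≡k ⟩
      t - a ⁻¹ * k           ≡⟨ cong (λ w → t - w) (*-comm (a ⁻¹) k) ⟩
      t - k * a ⁻¹           ∎
    checked : c ≡ t - k * a ⁻¹ → a * (t - c) ≡ k
    checked refl = begin
      a * (t - (t - k * a ⁻¹)) ≡⟨ cong (a *_) (x-[y-z]≡x-y+z t t (k * a ⁻¹)) ⟩
      a * (t - t + k * a ⁻¹)   ≡⟨ cong (λ w → a * (w + k * a ⁻¹)) (-‿inverseʳ t) ⟩
      a * (0# + k * a ⁻¹)      ≡⟨ cong (a *_) (trans (+-identityˡ (k * a ⁻¹)) (*-comm k (a ⁻¹))) ⟩
      a * (a ⁻¹ * k)           ≡⟨ x*[x⁻¹*y]≡y a≢0 k ⟩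
      k                        ∎

  a*e+k≡k′⇒a≡[k′-k]*e⁻¹ : ∀ {a e k k′} → Nonzero e → a * e + k ≡ k′ → a ≡ (k′ - k) * e ⁻¹
  a*e+k≡k′⇒a≡[k′-k]*e⁻¹ {a} {e} {k} {k′} e≢0 ae+k≡k′ = begin
    a                  ≡⟨ *-identityʳ a ⟨
    a * 1#             ≡⟨ cong (a *_) (x*x⁻¹≡1 e≢0) ⟨
    a * (e * e ⁻¹)     ≡⟨ *-assoc a e (e ⁻¹) ⟨
    a * e * e ⁻¹       ≡⟨ cong (_* e ⁻¹) (x+y-y≡x (a * e) k) ⟨
    (a * e + k - k) * e ⁻¹ ≡⟨ cong (λ w → (w - k) * e ⁻¹) ae+k≡k′ ⟩
    (k′ - k) * e ⁻¹    ∎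
    where open ≡-Reasoning

  _-ᵛ_ : ∀ {d} → Vec Carrier d → Vec Carrier d → Vec Carrier d
  []       -ᵛ []       = []
  (x ∷ xs) -ᵛ (y ∷ ys) = (x - y) ∷ (xs -ᵛ ys)

  private variable
    d : ℕ

  +ᵛ-assoc : ∀ (u v w : Vec Carrier d) → (u +ᵛ v) +ᵛ w ≡ u +ᵛ (v +ᵛ w)
  +ᵛ-assoc []       []       []       = refl
  +ᵛ-assoc (x ∷ u) (y ∷ v) (z ∷ w) = cong₂ _∷_ (+-assoc x y z) (+ᵛ-assoc u v w)

  u+v-v≡u : ∀ (u v : Vec Carrier d) → (u +ᵛ v) -ᵛ v ≡ u
  u+v-v≡u []      []      = refl
  u+v-v≡u (x ∷ u) (y ∷ v) = cong₂ _∷_ (x+y-y≡x x y) (u+v-v≡u u v)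

  u-v+v≡u : ∀ (u v : Vec Carrier d) → (u -ᵛ v) +ᵛ v ≡ u
  u-v+v≡u []      []      = refl
  u-v+v≡u (x ∷ u) (y ∷ v) = cong₂ _∷_ (x-y+y≡x x y) (u-v+v≡u u v)

  ·ᵛ-distribˡ-+ᵛ : ∀ x (u v : Vec Carrier d) → x ·ᵛ (u +ᵛ v) ≡ (x ·ᵛ u) +ᵛ (x ·ᵛ v)
  ·ᵛ-distribˡ-+ᵛ x []      []      = refl
  ·ᵛ-distribˡ-+ᵛ x (y ∷ u) (z ∷ v) = cong₂ _∷_ (distribˡ x y z) (·ᵛ-distribˡ-+ᵛ x u v)

  ·ᵛ-distribʳ-+ : ∀ x y (u : Vec Carrier d) → (x + y) ·ᵛ u ≡ (x ·ᵛ u) +ᵛ (y ·ᵛ u)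
  ·ᵛ-distribʳ-+ x y []      = refl
  ·ᵛ-distribʳ-+ x y (z ∷ u) = cong₂ _∷_ (distribʳ z x y) (·ᵛ-distribʳ-+ x y u)

  ·ᵛ-assoc : ∀ x y (u : Vec Carrier d) → (x * y) ·ᵛ u ≡ x ·ᵛ (y ·ᵛ u)
  ·ᵛ-assoc x y []      = refl
  ·ᵛ-assoc x y (z ∷ u) = cong₂ _∷_ (*-assoc x y z) (·ᵛ-assoc x y u)

  *ᵛ≡·ᵛ : ∀ (u : Vec Carrier d) x → u *ᵛ x ≡ x ·ᵛ u
  *ᵛ≡·ᵛ []      x = refl
  *ᵛ≡·ᵛ (y ∷ u) x = cong₂ _∷_ (*-comm y x) (*ᵛ≡·ᵛ u x)

  x·[x⁻¹·u]≡u : ∀ {x} → Nonzero x → ∀ (u : Vec Carrier d) → x ·ᵛ (x ⁻¹ ·ᵛ u) ≡ u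
  x·[x⁻¹·u]≡u x≢0 []      = refl
  x·[x⁻¹·u]≡u x≢0 (y ∷ u) = cong₂ _∷_ (x*[x⁻¹*y]≡y x≢0 y) (x·[x⁻¹·u]≡u x≢0 u)

  x⁻¹·[x·u]≡u : ∀ {x} → Nonzero x → ∀ (u : Vec Carrier d) → x ⁻¹ ·ᵛ (x ·ᵛ u) ≡ u
  x⁻¹·[x·u]≡u x≢0 []      = refl
  x⁻¹·[x·u]≡u x≢0 (y ∷ u) = cong₂ _∷_ (x⁻¹*[x*y]≡y x≢0 y) (x⁻¹·[x·u]≡u x≢0 u)

module Parabolas (F : FiniteField) where

  open FiniteFieldProperties F

  Point : Set
  Point = Carrier × Carrier

  points : List Point
  points = cartesianProduct elements elements

  ∑-points : ∀ (f : Point → ℕ) → ∑ points f ≡ ∑[ a ← elements ] ∑[ c ← elements ] f (a , c)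
  ∑-points = ∑-cartesianProduct elements elements

  OnParabola : Point → Point → Set
  OnParabola (a , c) (s , t) = a * (t - c) ≡ s * s

  onParabola? : ∀ p q → Dec (OnParabola p q)
  onParabola? (a , c) (s , t) = a * (t - c) ≟ s * s

  ∑-onParabola≡1 : ∀ {a} → Nonzero a → ∀ q → ∑[ c ← elements ] 𝟙 (onParabola? (a , c) q) ≡ 1
  ∑-onParabola≡1 {a} a≢0 (s , t) =
    Elements.∑-𝟙-unique (λ c → onParabola? (a , c) (s , t)) (t - s * s * a ⁻¹)
                        (λ c → a*[t-c]≡k⇔c≡t-k*a⁻¹ a≢0)

  -- The parabola through (s₁ , t₁) with parameter a has vertex (0 , t₁ - s₁² / a).
  ∑-onParabola-both : ∀ {a} → Nonzero a → ∀ s₁ t₁ s₂ t₂ →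
    ∑[ c ← elements ] (𝟙 (onParabola? (a , c) (s₁ , t₁)) ℕ.* 𝟙 (onParabola? (a , c) (s₂ , t₂)))
      ≡ 𝟙 (a * (t₂ - t₁) + s₁ * s₁ ≟ s₂ * s₂)
  ∑-onParabola-both {a} a≢0 s₁ t₁ s₂ t₂ = begin
    ∑[ c ← elements ] (𝟙 (onParabola? (a , c) (s₁ , t₁)) ℕ.* 𝟙 (onParabola? (a , c) (s₂ , t₂)))
      ≡⟨ Elements.∑-select-unique (λ c → onParabola? (a , c) (s₁ , t₁)) c₁ (λ c → a*[t-c]≡k⇔c≡t-k*a⁻¹ a≢0)
                                  (λ c → 𝟙 (onParabola? (a , c) (s₂ , t₂))) ⟩
    𝟙 (a * (t₂ - c₁) ≟ s₂ * s₂)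
      ≡⟨ 𝟙-cong (a * (t₂ - c₁) ≟ s₂ * s₂) (a * (t₂ - t₁) + s₁ * s₁ ≟ s₂ * s₂)
                (trans (sym shift)) (trans shift) ⟩
    𝟙 (a * (t₂ - t₁) + s₁ * s₁ ≟ s₂ * s₂) ∎
    where
    open ≡-Reasoning
    c₁ = t₁ - s₁ * s₁ * a ⁻¹
    shift : a * (t₂ - c₁) ≡ a * (t₂ - t₁) + s₁ * s₁
    shift = begin
      a * (t₂ - c₁)                               ≡⟨ cong (a *_) (x-[y-z]≡x-y+z t₂ t₁ (s₁ * s₁ * a ⁻¹)) ⟩
      a * (t₂ - t₁ + s₁ * s₁ * a ⁻¹)              ≡⟨ distribˡ a (t₂ - t₁) (s₁ * s₁ * a ⁻¹) ⟩
      a * (t₂ - t₁) + a * (s₁ * s₁ * a ⁻¹)        ≡⟨ cong (λ w → a * (t₂ - t₁) + a * w) (*-comm (s₁ * s₁) (a ⁻¹)) ⟩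
      a * (t₂ - t₁) + a * (a ⁻¹ * (s₁ * s₁))      ≡⟨ cong (a * (t₂ - t₁) +_) (x*[x⁻¹*y]≡y a≢0 (s₁ * s₁)) ⟩
      a * (t₂ - t₁) + s₁ * s₁                     ∎

  commonParabolas : Point → Point → ℕ
  commonParabolas q₁ q₂ =
    ∑[ p ← points ] (𝟙* (proj₁ p) ℕ.* (𝟙 (onParabola? p q₁) ℕ.* 𝟙 (onParabola? p q₂)))

  𝟙-mirror : Point → Point → ℕ
  𝟙-mirror (s₁ , t₁) (s₂ , t₂) = 𝟙 (t₂ ≟ t₁) ℕ.* 𝟙 (s₂ * s₂ ≟ s₁ * s₁)

  commonParabolas≡ : ∀ s₁ t₁ s₂ t₂ → commonParabolas (s₁ , t₁) (s₂ , t₂) ≡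
    ∑[ a ← elements ] (𝟙* a ℕ.* 𝟙 (a * (t₂ - t₁) + s₁ * s₁ ≟ s₂ * s₂))
  commonParabolas≡ s₁ t₁ s₂ t₂ = begin
    commonParabolas q₁ q₂
      ≡⟨ ∑-points _ ⟩
    ∑[ a ← elements ] ∑[ c ← elements ] (𝟙* a ℕ.* (𝟙 (onParabola? (a , c) q₁) ℕ.* 𝟙 (onParabola? (a , c) q₂)))
      ≡⟨ ∑-cong elements (λ a → ∑-*ˡ elements (𝟙* a) _) ⟩
    ∑[ a ← elements ] (𝟙* a ℕ.* ∑[ c ← elements ] (𝟙 (onParabola? (a , c) q₁) ℕ.* 𝟙 (onParabola? (a , c) q₂)))
      ≡⟨ ∑-cong elements (λ a → 𝟙*-cong a (λ a≢0 → ∑-onParabola-both a≢0 s₁ t₁ s₂ t₂)) ⟩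
    ∑[ a ← elements ] (𝟙* a ℕ.* 𝟙 (a * (t₂ - t₁) + s₁ * s₁ ≟ s₂ * s₂)) ∎
    where
    open ≡-Reasoning
    q₁ q₂ : Point
    q₁ = s₁ , t₁
    q₂ = s₂ , t₂

  commonParabolas-same-height : ∀ s₁ s₂ t → commonParabolas (s₁ , t) (s₂ , t) ≡ ∣F*∣ ℕ.* 𝟙 (s₂ * s₂ ≟ s₁ * s₁)
  commonParabolas-same-height s₁ s₂ t = begin
    commonParabolas (s₁ , t) (s₂ , t)
      ≡⟨ commonParabolas≡ s₁ t s₂ t ⟩
    ∑[ a ← elements ] (𝟙* a ℕ.* 𝟙 (a * (t - t) + s₁ * s₁ ≟ s₂ * s₂))
      ≡⟨ ∑-cong elements (λ a → cong (𝟙* a ℕ.*_)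
           (𝟙-cong (a * (t - t) + s₁ * s₁ ≟ s₂ * s₂) (s₂ * s₂ ≟ s₁ * s₁)
                   (λ e → sym (trans (sym (vanish a)) e)) (λ e → trans (vanish a) (sym e)))) ⟩
    ∑[ a ← elements ] (𝟙* a ℕ.* 𝟙 (s₂ * s₂ ≟ s₁ * s₁))
      ≡⟨ ∑-*ʳ elements _ 𝟙* ⟩
    ∣F*∣ ℕ.* 𝟙 (s₂ * s₂ ≟ s₁ * s₁) ∎
    where
    open ≡-Reasoning
    vanish : ∀ a → a * (t - t) + s₁ * s₁ ≡ s₁ * s₁
    vanish a = trans (cong (λ w → a * w + s₁ * s₁) (-‿inverseʳ t))
                     (trans (cong (_+ s₁ * s₁) (zeroʳ a)) (+-identityˡ (s₁ * s₁)))

  commonParabolas-≤1 : ∀ s₁ t₁ s₂ t₂ → t₂ ≢ t₁ → commonParabolas (s₁ , t₁) (s₂ , t₂) ≤ 1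
  commonParabolas-≤1 s₁ t₁ s₂ t₂ t₂≢t₁ = begin
    commonParabolas (s₁ , t₁) (s₂ , t₂)
      ≡⟨ commonParabolas≡ s₁ t₁ s₂ t₂ ⟩
    ∑[ a ← elements ] (𝟙* a ℕ.* 𝟙 (a * (t₂ - t₁) + s₁ * s₁ ≟ s₂ * s₂))
      ≤⟨ ∑-mono-≤ elements (λ a → ℕ.≤-trans (ℕ.*-monoˡ-≤ _ (𝟙-≤1 (¬? (a ≟ 0#)))) (ℕ.≤-reflexive (ℕ.*-identityˡ _))) ⟩
    ∑[ a ← elements ] 𝟙 (a * (t₂ - t₁) + s₁ * s₁ ≟ s₂ * s₂)
      ≤⟨ ∑-mono-≤ elements (λ a → 𝟙-mono (a * (t₂ - t₁) + s₁ * s₁ ≟ s₂ * s₂) (a ≟ a₀)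
                                        (a*e+k≡k′⇒a≡[k′-k]*e⁻¹ t₂-t₁≢0)) ⟩
    ∑[ a ← elements ] 𝟙 (a ≟ a₀)
      ≡⟨ elements-enumeration a₀ ⟩
    1 ∎
    where
    open ℕ.≤-Reasoning
    a₀ = (s₂ * s₂ - s₁ * s₁) * (t₂ - t₁) ⁻¹
    t₂-t₁≢0 : Nonzero (t₂ - t₁)
    t₂-t₁≢0 e = t₂≢t₁ (x∙y⁻¹≈ε⇒x≈y t₂ t₁ e)

  commonParabolas-≤ : ∀ q₁ q₂ → commonParabolas q₁ q₂ ≤ 1 ℕ.+ ∣F*∣ ℕ.* 𝟙-mirror q₁ q₂
  commonParabolas-≤ (s₁ , t₁) (s₂ , t₂) with t₂ ≟ t₁
  ... | yes refl = ℕ.≤-trans (ℕ.≤-reflexive (trans (commonParabolas-same-height s₁ s₂ t₂)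
                                                    (cong (∣F*∣ ℕ.*_) (sym (ℕ.+-identityʳ _)))))
                             (ℕ.m≤n+m _ 1)
  ... | no t₂≢t₁ = ℕ.≤-trans (commonParabolas-≤1 s₁ t₁ s₂ t₂ t₂≢t₁) (ℕ.m≤m+n 1 _)

  ∑-𝟙-mirror≤2 : ∀ q₁ → ∑[ q₂ ← points ] 𝟙-mirror q₁ q₂ ≤ 2
  ∑-𝟙-mirror≤2 (s₁ , t₁) = begin
    ∑[ q₂ ← points ] 𝟙-mirror (s₁ , t₁) q₂
      ≡⟨ ∑-points _ ⟩
    ∑[ s₂ ← elements ] ∑[ t₂ ← elements ] (𝟙 (t₂ ≟ t₁) ℕ.* 𝟙 (s₂ * s₂ ≟ s₁ * s₁))
      ≡⟨ ∑-cong elements (λ s₂ → Elements.∑-select t₁ (λ _ → 𝟙 (s₂ * s₂ ≟ s₁ * s₁))) ⟩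
    ∑[ s₂ ← elements ] 𝟙 (s₂ * s₂ ≟ s₁ * s₁)
      ≤⟨ ∑-mono-≤ elements square-roots ⟩
    ∑[ s₂ ← elements ] (𝟙 (s₂ ≟ s₁) ℕ.+ 𝟙 (s₂ ≟ - s₁))
      ≡⟨ ∑-distrib-+ elements _ _ ⟩
    ∑[ s₂ ← elements ] 𝟙 (s₂ ≟ s₁) ℕ.+ ∑[ s₂ ← elements ] 𝟙 (s₂ ≟ - s₁)
      ≡⟨ cong₂ ℕ._+_ (elements-enumeration s₁) (elements-enumeration (- s₁)) ⟩
    2 ∎
    where
    open ℕ.≤-Reasoning
    square-roots : ∀ s₂ → 𝟙 (s₂ * s₂ ≟ s₁ * s₁) ≤ 𝟙 (s₂ ≟ s₁) ℕ.+ 𝟙 (s₂ ≟ - s₁)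
    square-roots s₂ with s₂ * s₂ ≟ s₁ * s₁
    ... | no _ = z≤n
    ... | yes s₂²≡s₁² with x*x≡y*y⇒x≡y⊎x≡-y s₂²≡s₁²
    ...   | inj₁ s₂≡s₁  = ℕ.≤-trans (ℕ.≤-reflexive (sym (𝟙-yes (s₂ ≟ s₁) s₂≡s₁))) (ℕ.m≤m+n _ _)
    ...   | inj₂ s₂≡-s₁ = ℕ.≤-trans (ℕ.≤-reflexive (sym (𝟙-yes (s₂ ≟ - s₁) s₂≡-s₁))) (ℕ.m≤n+m _ _)

  module ParabolaFreeSet {S : Point → Set} (S? : Decidable S)
    (S-off-axis : ∀ t → ¬ S (0# , t))
    (S-parabola-free : ∀ p q → S p → S q → ¬ OnParabola p q) where

    𝟙S : Point → ℕ
    𝟙S p = 𝟙 (S? p)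

    ∣S∣ : ℕ
    ∣S∣ = ∑ points 𝟙S

    incidences 𝟙∁S : Point → ℕ
    incidences p = 𝟙* (proj₁ p) ℕ.* ∑[ q ← points ] (𝟙S q ℕ.* 𝟙 (onParabola? p q))
    𝟙∁S p = 𝟙* (proj₁ p) ℕ.* 𝟙 (¬? (S? p))

    ∑-incidences : ∑ points incidences ≡ ∣F*∣ ℕ.* ∣S∣
    ∑-incidences = begin
      ∑ points incidences
        ≡⟨ ∑-points incidences ⟩
      ∑[ a ← elements ] ∑[ c ← elements ] incidences (a , c)
        ≡⟨ ∑-cong elements (λ a → ∑-*ˡ elements (𝟙* a) _) ⟩
      ∑[ a ← elements ] (𝟙* a ℕ.* ∑[ c ← elements ] ∑[ q ← points ] (𝟙S q ℕ.* 𝟙 (onParabola? (a , c) q)))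
        ≡⟨ ∑-cong elements (λ a → 𝟙*-cong a (λ a≢0 → trans (∑-comm elements points _)
             (∑-cong points (λ q → trans (∑-*ˡ elements (𝟙S q) _)
                                          (trans (cong (𝟙S q ℕ.*_) (∑-onParabola≡1 a≢0 q)) (ℕ.*-identityʳ _)))))) ⟩
      ∑[ a ← elements ] (𝟙* a ℕ.* ∣S∣)
        ≡⟨ ∑-*ʳ elements ∣S∣ 𝟙* ⟩
      ∣F*∣ ℕ.* ∣S∣ ∎
      where open ≡-Reasoning

    incidences-on-S : ∀ p → S p → incidences p ≡ 0
    incidences-on-S p Sp = trans (cong (𝟙* (proj₁ p) ℕ.*_) (∑-zero points none)) (ℕ.*-zeroʳ (𝟙* (proj₁ p)))
      where
      none : ∀ q → 𝟙S q ℕ.* 𝟙 (onParabola? p q) ≡ 0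
      none q with S? q | onParabola? p q
      ... | no _   | _       = refl
      ... | yes _  | no _    = refl
      ... | yes Sq | yes p∋q = ⊥-elim (S-parabola-free p q Sp Sq p∋q)

    incidences-off-S : ∀ p → incidences p ≡ 𝟙∁S p ℕ.* incidences p
    incidences-off-S p@(a , c) with S? p
    ... | yes Sp = trans (incidences-on-S p Sp) (sym (cong (ℕ._* incidences p) (ℕ.*-zeroʳ (𝟙* a))))
    ... | no _ with a ≟ 0#
    ...   | yes _ = refl
    ...   | no _  = sym (ℕ.*-identityˡ _)

    𝟙∁S+𝟙S≡𝟙* : ∀ p → 𝟙∁S p ℕ.+ 𝟙S p ≡ 𝟙* (proj₁ p)
    𝟙∁S+𝟙S≡𝟙* p@(a , c) with a ≟ 0# | S? p
    ... | yes refl | yes Sp = ⊥-elim (S-off-axis c Sp)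
    ... | yes _    | no _   = refl
    ... | no _     | yes _  = refl
    ... | no _     | no _   = refl

    ∑-𝟙∁S+∣S∣ : ∑ points 𝟙∁S ℕ.+ ∣S∣ ≡ card ℕ.* ∣F*∣
    ∑-𝟙∁S+∣S∣ = begin
      ∑ points 𝟙∁S ℕ.+ ∣S∣                                 ≡⟨ ∑-distrib-+ points 𝟙∁S 𝟙S ⟨
      ∑[ p ← points ] (𝟙∁S p ℕ.+ 𝟙S p)                      ≡⟨ ∑-cong points 𝟙∁S+𝟙S≡𝟙* ⟩
      ∑[ p ← points ] 𝟙* (proj₁ p)                          ≡⟨ ∑-points _ ⟩
      ∑[ a ← elements ] ∑[ _ ← elements ] 𝟙* a              ≡⟨ ∑-cong elements (λ a → ∑-const elements (𝟙* a)) ⟩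
      ∑[ a ← elements ] (length elements ℕ.* 𝟙* a)          ≡⟨ ∑-*ˡ elements (length elements) 𝟙* ⟩
      length elements ℕ.* ∣F*∣                              ≡⟨ cong (ℕ._* ∣F*∣) length-elements ⟩
      card ℕ.* ∣F*∣                                          ∎
      where open ≡-Reasoning

    incidences² : ∀ p → incidences p ℕ.* incidences p ≡
      ∑[ q₁ ← points ] ∑[ q₂ ← points ]
        ((𝟙S q₁ ℕ.* 𝟙S q₂) ℕ.* (𝟙* (proj₁ p) ℕ.* (𝟙 (onParabola? p q₁) ℕ.* 𝟙 (onParabola? p q₂))))
    incidences² p@(a , c) = begin
      (𝟙* a ℕ.* X) ℕ.* (𝟙* a ℕ.* X)                    ≡⟨ square-product (𝟙* a) X ⟩
      (𝟙* a ℕ.* 𝟙* a) ℕ.* (X ℕ.* X)                    ≡⟨ cong (ℕ._* (X ℕ.* X)) (𝟙-idem (¬? (a ≟ 0#))) ⟩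
      𝟙* a ℕ.* (X ℕ.* X)                               ≡⟨ cong (𝟙* a ℕ.*_) (∑-*-∑ points points f f) ⟩
      𝟙* a ℕ.* ∑[ q₁ ← points ] ∑[ q₂ ← points ] (f q₁ ℕ.* f q₂)
        ≡⟨ trans (∑-cong points (λ q₁ → ∑-*ˡ points (𝟙* a) _)) (∑-*ˡ points (𝟙* a) _) ⟨
      ∑[ q₁ ← points ] ∑[ q₂ ← points ] (𝟙* a ℕ.* (f q₁ ℕ.* f q₂))
        ≡⟨ ∑-cong points (λ q₁ → ∑-cong points (λ q₂ → regroup (𝟙* a) (𝟙S q₁) (𝟙S q₂) _ _)) ⟩
      ∑[ q₁ ← points ] ∑[ q₂ ← points ]
        ((𝟙S q₁ ℕ.* 𝟙S q₂) ℕ.* (𝟙* a ℕ.* (𝟙 (onParabola? p q₁) ℕ.* 𝟙 (onParabola? p q₂)))) ∎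
      where
      open ≡-Reasoning
      f : Point → ℕ
      f q = 𝟙S q ℕ.* 𝟙 (onParabola? p q)
      X = ∑ points f
      square-product : ∀ m n → (m ℕ.* n) ℕ.* (m ℕ.* n) ≡ (m ℕ.* m) ℕ.* (n ℕ.* n)
      square-product = solve-∀
      regroup : ∀ k s₁ s₂ r₁ r₂ → k ℕ.* ((s₁ ℕ.* r₁) ℕ.* (s₂ ℕ.* r₂)) ≡ (s₁ ℕ.* s₂) ℕ.* (k ℕ.* (r₁ ℕ.* r₂))
      regroup = solve-∀

    ∑-incidences²≡ : ∑[ p ← points ] (incidences p ℕ.* incidences p) ≡
      ∑[ q₁ ← points ] ∑[ q₂ ← points ] ((𝟙S q₁ ℕ.* 𝟙S q₂) ℕ.* commonParabolas q₁ q₂)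
    ∑-incidences²≡ = begin
      ∑[ p ← points ] (incidences p ℕ.* incidences p)
        ≡⟨ ∑-cong points incidences² ⟩
      ∑[ p ← points ] ∑[ q₁ ← points ] ∑[ q₂ ← points ] ((𝟙S q₁ ℕ.* 𝟙S q₂) ℕ.* g p q₁ q₂)
        ≡⟨ ∑-comm points points _ ⟩
      ∑[ q₁ ← points ] ∑[ p ← points ] ∑[ q₂ ← points ] ((𝟙S q₁ ℕ.* 𝟙S q₂) ℕ.* g p q₁ q₂)
        ≡⟨ ∑-cong points (λ q₁ → ∑-comm points points _) ⟩
      ∑[ q₁ ← points ] ∑[ q₂ ← points ] ∑[ p ← points ] ((𝟙S q₁ ℕ.* 𝟙S q₂) ℕ.* g p q₁ q₂)
        ≡⟨ ∑-cong points (λ q₁ → ∑-cong points (λ q₂ → ∑-*ˡ points (𝟙S q₁ ℕ.* 𝟙S q₂) _)) ⟩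
      ∑[ q₁ ← points ] ∑[ q₂ ← points ] ((𝟙S q₁ ℕ.* 𝟙S q₂) ℕ.* commonParabolas q₁ q₂) ∎
      where
      open ≡-Reasoning
      g : Point → Point → Point → ℕ
      g p q₁ q₂ = 𝟙* (proj₁ p) ℕ.* (𝟙 (onParabola? p q₁) ℕ.* 𝟙 (onParabola? p q₂))

    𝟙S²*commonParabolas-≤ : ∀ q₁ q₂ → (𝟙S q₁ ℕ.* 𝟙S q₂) ℕ.* commonParabolas q₁ q₂ ≤
                                      𝟙S q₁ ℕ.* 𝟙S q₂ ℕ.+ ∣F*∣ ℕ.* (𝟙S q₁ ℕ.* 𝟙-mirror q₁ q₂)
    𝟙S²*commonParabolas-≤ q₁ q₂ = begin
      (𝟙S q₁ ℕ.* 𝟙S q₂) ℕ.* commonParabolas q₁ q₂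
        ≤⟨ ℕ.*-monoʳ-≤ (𝟙S q₁ ℕ.* 𝟙S q₂) (commonParabolas-≤ q₁ q₂) ⟩
      (𝟙S q₁ ℕ.* 𝟙S q₂) ℕ.* (1 ℕ.+ ∣F*∣ ℕ.* 𝟙-mirror q₁ q₂)
        ≡⟨ expand (𝟙S q₁) (𝟙S q₂) ∣F*∣ (𝟙-mirror q₁ q₂) ⟩
      𝟙S q₁ ℕ.* 𝟙S q₂ ℕ.+ ∣F*∣ ℕ.* (𝟙S q₁ ℕ.* (𝟙S q₂ ℕ.* 𝟙-mirror q₁ q₂))
        ≤⟨ ℕ.+-monoʳ-≤ (𝟙S q₁ ℕ.* 𝟙S q₂) (ℕ.*-monoʳ-≤ ∣F*∣ (ℕ.*-monoʳ-≤ (𝟙S q₁) drop-𝟙S)) ⟩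
      𝟙S q₁ ℕ.* 𝟙S q₂ ℕ.+ ∣F*∣ ℕ.* (𝟙S q₁ ℕ.* 𝟙-mirror q₁ q₂) ∎
      where
      open ℕ.≤-Reasoning
      expand : ∀ s₁ s₂ Q m → (s₁ ℕ.* s₂) ℕ.* (1 ℕ.+ Q ℕ.* m) ≡ s₁ ℕ.* s₂ ℕ.+ Q ℕ.* (s₁ ℕ.* (s₂ ℕ.* m))
      expand = solve-∀
      drop-𝟙S : 𝟙S q₂ ℕ.* 𝟙-mirror q₁ q₂ ≤ 𝟙-mirror q₁ q₂
      drop-𝟙S = ℕ.≤-trans (ℕ.*-monoˡ-≤ _ (𝟙-≤1 (S? q₂))) (ℕ.≤-reflexive (ℕ.*-identityˡ _))

    ∑-incidences²-≤ : ∑[ p ← points ] (incidences p ℕ.* incidences p) ≤ ∣S∣ ℕ.* ∣S∣ ℕ.+ ∣F*∣ ℕ.* (∣S∣ ℕ.* 2)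
    ∑-incidences²-≤ = begin
      ∑[ p ← points ] (incidences p ℕ.* incidences p)
        ≡⟨ ∑-incidences²≡ ⟩
      ∑[ q₁ ← points ] ∑[ q₂ ← points ] ((𝟙S q₁ ℕ.* 𝟙S q₂) ℕ.* commonParabolas q₁ q₂)
        ≤⟨ ∑-mono-≤ points (λ q₁ → ∑-mono-≤ points (𝟙S²*commonParabolas-≤ q₁)) ⟩
      ∑[ q₁ ← points ] ∑[ q₂ ← points ] (𝟙S q₁ ℕ.* 𝟙S q₂ ℕ.+ ∣F*∣ ℕ.* (𝟙S q₁ ℕ.* 𝟙-mirror q₁ q₂))
        ≡⟨ trans (∑-cong points (λ q₁ → ∑-distrib-+ points _ _)) (∑-distrib-+ points _ _) ⟩
      ∑[ q₁ ← points ] ∑[ q₂ ← points ] (𝟙S q₁ ℕ.* 𝟙S q₂)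
        ℕ.+ ∑[ q₁ ← points ] ∑[ q₂ ← points ] (∣F*∣ ℕ.* (𝟙S q₁ ℕ.* 𝟙-mirror q₁ q₂))
        ≡⟨ cong₂ ℕ._+_ (sym (∑-*-∑ points points 𝟙S 𝟙S))
                       (∑-cong points (λ q₁ → trans (∑-*ˡ points ∣F*∣ _) (cong (∣F*∣ ℕ.*_) (∑-*ˡ points (𝟙S q₁) _)))) ⟩
      ∣S∣ ℕ.* ∣S∣ ℕ.+ ∑[ q₁ ← points ] (∣F*∣ ℕ.* (𝟙S q₁ ℕ.* ∑[ q₂ ← points ] 𝟙-mirror q₁ q₂))
        ≤⟨ ℕ.+-monoʳ-≤ (∣S∣ ℕ.* ∣S∣)
             (∑-mono-≤ points (λ q₁ → ℕ.*-monoʳ-≤ ∣F*∣ (ℕ.*-monoʳ-≤ (𝟙S q₁) (∑-𝟙-mirror≤2 q₁)))) ⟩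
      ∣S∣ ℕ.* ∣S∣ ℕ.+ ∑[ q₁ ← points ] (∣F*∣ ℕ.* (𝟙S q₁ ℕ.* 2))
        ≡⟨ cong (∣S∣ ℕ.* ∣S∣ ℕ.+_) (trans (∑-*ˡ points ∣F*∣ _) (cong (∣F*∣ ℕ.*_) (∑-*ʳ points 2 𝟙S))) ⟩
      ∣S∣ ℕ.* ∣S∣ ℕ.+ ∣F*∣ ℕ.* (∣S∣ ℕ.* 2) ∎
      where open ℕ.≤-Reasoning

    ∣S∣²-≤ : ∣S∣ ℕ.* ∣S∣ ≤ 2 ℕ.* suc ∣F*∣ ℕ.* ∣F*∣ ℕ.* ∣F*∣
    ∣S∣²-≤ = Q²n²≤m[n²+2Qn]⇒n²≤2[1+Q]Q² ∣F*∣ ∣S∣ (∑ points 𝟙∁S) cauchy-schwarz-bound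
               (trans ∑-𝟙∁S+∣S∣ (cong (ℕ._* ∣F*∣) card≡1+∣F*∣))
      where
      open ℕ.≤-Reasoning
      cauchy-schwarz-bound : (∣F*∣ ℕ.* ∣S∣) ℕ.* (∣F*∣ ℕ.* ∣S∣) ≤ ∑ points 𝟙∁S ℕ.* (∣S∣ ℕ.* ∣S∣ ℕ.+ ∣F*∣ ℕ.* (∣S∣ ℕ.* 2))
      cauchy-schwarz-bound = begin
        (∣F*∣ ℕ.* ∣S∣) ℕ.* (∣F*∣ ℕ.* ∣S∣)
          ≡⟨ cong (λ n → n ℕ.* n) (trans (sym ∑-incidences) (∑-cong points incidences-off-S)) ⟩
        ∑[ p ← points ] (𝟙∁S p ℕ.* incidences p) ℕ.* ∑[ p ← points ] (𝟙∁S p ℕ.* incidences p)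
          ≤⟨ cauchy-schwarz points 𝟙∁S incidences ⟩
        ∑[ p ← points ] (𝟙∁S p ℕ.* 𝟙∁S p) ℕ.* ∑[ p ← points ] (incidences p ℕ.* incidences p)
          ≡⟨ cong (ℕ._* ∑[ p ← points ] (incidences p ℕ.* incidences p)) (∑-cong points 𝟙∁S-idem) ⟩
        ∑ points 𝟙∁S ℕ.* ∑[ p ← points ] (incidences p ℕ.* incidences p)
          ≤⟨ ℕ.*-monoʳ-≤ (∑ points 𝟙∁S) ∑-incidences²-≤ ⟩
        ∑ points 𝟙∁S ℕ.* (∣S∣ ℕ.* ∣S∣ ℕ.+ ∣F*∣ ℕ.* (∣S∣ ℕ.* 2)) ∎
        where
        𝟙∁S-idem : ∀ p → 𝟙∁S p ℕ.* 𝟙∁S p ≡ 𝟙∁S p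
        𝟙∁S-idem (a , c) = trans (square-product (𝟙* a) _)
          (cong₂ ℕ._*_ (𝟙-idem (¬? (a ≟ 0#))) (𝟙-idem (¬? (S? (a , c)))))
          where
          square-product : ∀ m n → (m ℕ.* n) ℕ.* (m ℕ.* n) ≡ (m ℕ.* m) ℕ.* (n ℕ.* n)
          square-product = solve-∀

module Slices (F : FiniteField) {d : ℕ} (B : FiniteField.Subset F (suc d))
              (α₁ : FiniteField.Carrier F) (α′ : Vec (FiniteField.Carrier F) d)
              (α₁≢0 : FiniteField.Nonzero F α₁) where

  open FiniteFieldProperties F
  open Parabolas F

  α : Vec Carrier (suc d)
  α = α₁ ∷ α′

  𝟙B : Vec Carrier (suc d) → ℕ
  𝟙B x = 𝟙 (B x Bool.≟ true)

  chart : Vec Carrier d → Point → Vec Carrier (suc d)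
  chart v (s , t) = s ⁻¹ ·ᵛ ((0# ∷ v) +ᵛ (t ·ᵛ α))

  ∑-chart : ∀ {s} → Nonzero s → ∑[ v ← allVecs d ] ∑[ t ← elements ] 𝟙B (chart v (s , t)) ≡ ∣ B ∣
  ∑-chart {s} s≢0 = begin
    ∑[ v ← allVecs d ] ∑[ t ← elements ] 𝟙B (chart v (s , t))
      ≡⟨ ∑-comm (allVecs d) elements _ ⟩
    ∑[ t ← elements ] ∑[ v ← allVecs d ] 𝟙B (s ⁻¹ * (0# + t * α₁) ∷ s ⁻¹ ·ᵛ (v +ᵛ (t ·ᵛ α′)))
      ≡⟨ ∑-cong elements (λ t → Vectors.∑-reindex (λ v → s ⁻¹ ·ᵛ (v +ᵛ (t ·ᵛ α′))) (λ w → (s ·ᵛ w) -ᵛ (t ·ᵛ α′))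
                                   (τσ t) (στ t) (λ w → 𝟙B (s ⁻¹ * (0# + t * α₁) ∷ w))) ⟩
    ∑[ t ← elements ] ∑[ w ← allVecs d ] 𝟙B (s ⁻¹ * (0# + t * α₁) ∷ w)
      ≡⟨ Elements.∑-reindex (λ t → s ⁻¹ * (0# + t * α₁)) (λ x → s * x * α₁ ⁻¹) τσ₁ στ₁
                            (λ x → ∑[ w ← allVecs d ] 𝟙B (x ∷ w)) ⟩
    ∑[ x ← elements ] ∑[ w ← allVecs d ] 𝟙B (x ∷ w)
      ≡⟨ ∑-allVecs-suc d 𝟙B ⟨
    ∑ (allVecs (suc d)) 𝟙B
      ≡⟨ length-filter≡∑𝟙 (λ x → B x Bool.≟ true) (allVecs (suc d)) ⟨
    ∣ B ∣ ∎
    where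
    open ≡-Reasoning
    τσ : ∀ t v → (s ·ᵛ (s ⁻¹ ·ᵛ (v +ᵛ (t ·ᵛ α′)))) -ᵛ (t ·ᵛ α′) ≡ v
    τσ t v = trans (cong (_-ᵛ (t ·ᵛ α′)) (x·[x⁻¹·u]≡u s≢0 _)) (u+v-v≡u v _)
    στ : ∀ t w → s ⁻¹ ·ᵛ (((s ·ᵛ w) -ᵛ (t ·ᵛ α′)) +ᵛ (t ·ᵛ α′)) ≡ w
    στ t w = trans (cong (s ⁻¹ ·ᵛ_) (u-v+v≡u _ _)) (x⁻¹·[x·u]≡u s≢0 w)
    τσ₁ : ∀ t → s * (s ⁻¹ * (0# + t * α₁)) * α₁ ⁻¹ ≡ t
    τσ₁ t = trans (cong (_* α₁ ⁻¹) (trans (x*[x⁻¹*y]≡y s≢0 _) (+-identityˡ _))) (x*y*y⁻¹≡x α₁≢0 t)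
    στ₁ : ∀ x → s ⁻¹ * (0# + s * x * α₁ ⁻¹ * α₁) ≡ x
    στ₁ x = trans (cong (s ⁻¹ *_) (trans (+-identityˡ _) (x*y⁻¹*y≡x α₁≢0 (s * x)))) (x⁻¹*[x*y]≡y s≢0 x)

  Slice : Vec Carrier d → Point → Set
  Slice v (s , t) = Nonzero s × chart v (s , t) ∈ B

  slice? : ∀ v → Decidable (Slice v)
  slice? v (s , t) = ¬? (s ≟ 0#) ×-dec (B (chart v (s , t)) Bool.≟ true)

  ∣slice∣ : Vec Carrier d → ℕ
  ∣slice∣ v = ∑[ p ← points ] 𝟙 (slice? v p)

  ∑-∣slice∣ : ∑[ v ← allVecs d ] ∣slice∣ v ≡ ∣F*∣ ℕ.* ∣ B ∣
  ∑-∣slice∣ = begin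
    ∑[ v ← allVecs d ] ∣slice∣ v
      ≡⟨ ∑-cong (allVecs d) (λ v → trans (∑-points _) (∑-cong elements (λ s →
           trans (∑-cong elements (λ t → 𝟙-× (¬? (s ≟ 0#)) _)) (∑-*ˡ elements (𝟙* s) _)))) ⟩
    ∑[ v ← allVecs d ] ∑[ s ← elements ] (𝟙* s ℕ.* ∑[ t ← elements ] 𝟙B (chart v (s , t)))
      ≡⟨ ∑-comm (allVecs d) elements _ ⟩
    ∑[ s ← elements ] ∑[ v ← allVecs d ] (𝟙* s ℕ.* ∑[ t ← elements ] 𝟙B (chart v (s , t)))
      ≡⟨ ∑-cong elements (λ s → trans (∑-*ˡ (allVecs d) (𝟙* s) _) (𝟙*-cong s ∑-chart)) ⟩
    ∑[ s ← elements ] (𝟙* s ℕ.* ∣ B ∣)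
      ≡⟨ ∑-*ʳ elements ∣ B ∣ 𝟙* ⟩
    ∣F*∣ ℕ.* ∣ B ∣ ∎
    where open ≡-Reasoning

  chart-+ᵛ : ∀ v {a s c t} → Nonzero s → c + s * s * a ⁻¹ ≡ t →
    chart v (s , c) +ᵛ ((s * a ⁻¹) ·ᵛ α) ≡ chart v (s , t)
  chart-+ᵛ v {a} {s} {c} {t} s≢0 c+s²/a≡t = begin
    (s ⁻¹ ·ᵛ e) +ᵛ ((s * a ⁻¹) ·ᵛ α)                ≡⟨ cong (λ x → (s ⁻¹ ·ᵛ e) +ᵛ (x ·ᵛ α)) s/a≡s⁻¹K ⟩
    (s ⁻¹ ·ᵛ e) +ᵛ ((s ⁻¹ * K) ·ᵛ α)                ≡⟨ cong ((s ⁻¹ ·ᵛ e) +ᵛ_) (·ᵛ-assoc (s ⁻¹) K α) ⟩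
    (s ⁻¹ ·ᵛ e) +ᵛ (s ⁻¹ ·ᵛ (K ·ᵛ α))               ≡⟨ ·ᵛ-distribˡ-+ᵛ (s ⁻¹) e (K ·ᵛ α) ⟨
    s ⁻¹ ·ᵛ (e +ᵛ (K ·ᵛ α))                         ≡⟨ cong (s ⁻¹ ·ᵛ_) (+ᵛ-assoc (0# ∷ v) (c ·ᵛ α) (K ·ᵛ α)) ⟩
    s ⁻¹ ·ᵛ ((0# ∷ v) +ᵛ ((c ·ᵛ α) +ᵛ (K ·ᵛ α)))    ≡⟨ cong (λ w → s ⁻¹ ·ᵛ ((0# ∷ v) +ᵛ w)) (·ᵛ-distribʳ-+ c K α) ⟨
    s ⁻¹ ·ᵛ ((0# ∷ v) +ᵛ ((c + K) ·ᵛ α))            ≡⟨ cong (λ x → s ⁻¹ ·ᵛ ((0# ∷ v) +ᵛ (x ·ᵛ α))) c+s²/a≡t ⟩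
    s ⁻¹ ·ᵛ ((0# ∷ v) +ᵛ (t ·ᵛ α))                  ∎
    where
    open ≡-Reasoning
    e = (0# ∷ v) +ᵛ (c ·ᵛ α)
    K = s * s * a ⁻¹
    s/a≡s⁻¹K : s * a ⁻¹ ≡ s ⁻¹ * K
    s/a≡s⁻¹K = trans (sym (x⁻¹*[x*y]≡y s≢0 (s * a ⁻¹))) (cong (s ⁻¹ *_) (sym (*-assoc s s (a ⁻¹))))

  chart-*ᵛ : ∀ v {a s c} → Nonzero s → chart v (s , c) *ᵛ (s * a ⁻¹) ≡ chart v (a , c)
  chart-*ᵛ v {a} {s} {c} s≢0 = begin
    (s ⁻¹ ·ᵛ e) *ᵛ (s * a ⁻¹)      ≡⟨ *ᵛ≡·ᵛ (s ⁻¹ ·ᵛ e) (s * a ⁻¹) ⟩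
    (s * a ⁻¹) ·ᵛ (s ⁻¹ ·ᵛ e)      ≡⟨ ·ᵛ-assoc (s * a ⁻¹) (s ⁻¹) e ⟨
    (s * a ⁻¹ * s ⁻¹) ·ᵛ e         ≡⟨ cong (λ x → (x * s ⁻¹) ·ᵛ e) (*-comm s (a ⁻¹)) ⟩
    (a ⁻¹ * s * s ⁻¹) ·ᵛ e         ≡⟨ cong (_·ᵛ e) (x*y*y⁻¹≡x s≢0 (a ⁻¹)) ⟩
    a ⁻¹ ·ᵛ e                      ∎
    where
    open ≡-Reasoning
    e = (0# ∷ v) +ᵛ (c ·ᵛ α)

  module _ (no-witness : ∀ y u → Nonzero u → (y +ᵛ (u ·ᵛ α)) ∈ B → (y *ᵛ u) ∈ B → ⊥) where

    slice-parabola-free : ∀ v p q → Slice v p → Slice v q → ¬ OnParabola p q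
    slice-parabola-free v (a , c) (s , t) (a≢0 , ac∈B) (s≢0 , st∈B) a[t-c]≡s² =
      no-witness (chart v (s , c)) (s * a ⁻¹) (*-nonzero s≢0 (⁻¹-nonzero a≢0))
        (subst (_∈ B) (sym (chart-+ᵛ v s≢0 c+s²/a≡t)) st∈B)
        (subst (_∈ B) (sym (chart-*ᵛ v s≢0)) ac∈B)
      where
      c+s²/a≡t : c + s * s * a ⁻¹ ≡ t
      c+s²/a≡t = trans (cong (_+ s * s * a ⁻¹) (Equivalence.to (a*[t-c]≡k⇔c≡t-k*a⁻¹ a≢0) a[t-c]≡s²))
                       (x-y+y≡x t (s * s * a ⁻¹))

    ∣slice∣²-≤ : ∀ v → ∣slice∣ v ℕ.* ∣slice∣ v ≤ 2 ℕ.* suc ∣F*∣ ℕ.* ∣F*∣ ℕ.* ∣F*∣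
    ∣slice∣²-≤ v = ParabolaFreeSet.∣S∣²-≤ (slice? v) (λ t (0≢0 , _) → 0≢0 refl) (slice-parabola-free v)

    [∣F*∣*∣B∣]²-≤ : (∣F*∣ ℕ.* ∣ B ∣) ℕ.* (∣F*∣ ℕ.* ∣ B ∣) ≤
                    (card ^ d ℕ.* card ^ d) ℕ.* (2 ℕ.* suc ∣F*∣ ℕ.* ∣F*∣ ℕ.* ∣F*∣)
    [∣F*∣*∣B∣]²-≤ = subst₂ _≤_ (cong (λ n → n ℕ.* n) ∑-∣slice∣)
                              (cong (λ l → (l ℕ.* l) ℕ.* (2 ℕ.* suc ∣F*∣ ℕ.* ∣F*∣ ℕ.* ∣F*∣)) (length-allVecs d))
                              (∑-square-≤ (allVecs d) ∣slice∣ ∣slice∣²-≤)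

    ∣B∣²*card≤2*card^[2d+2] : (∣ B ∣ ℕ.* ∣ B ∣) ℕ.* card ≤ 2 ℕ.* card ^ (2 ℕ.* suc d)
    ∣B∣²*card≤2*card^[2d+2] = begin
      ∣ B ∣ ℕ.* ∣ B ∣ ℕ.* card
        ≡⟨ cong (∣ B ∣ ℕ.* ∣ B ∣ ℕ.*_) card≡1+∣F*∣ ⟩
      ∣ B ∣ ℕ.* ∣ B ∣ ℕ.* suc ∣F*∣
        ≤⟨ [Qb]²≤P[2[1+Q]Q²]⇒b²[1+Q]≤2P[1+Q]² ∣F*∣ ∣ B ∣ (card ^ d ℕ.* card ^ d) 1≤∣F*∣ [∣F*∣*∣B∣]²-≤ ⟩
      2 ℕ.* (card ^ d ℕ.* card ^ d ℕ.* (suc ∣F*∣ ℕ.* suc ∣F*∣))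
        ≡⟨ cong (λ q → 2 ℕ.* (card ^ d ℕ.* card ^ d ℕ.* (q ℕ.* q))) card≡1+∣F*∣ ⟨
      2 ℕ.* (card ^ d ℕ.* card ^ d ℕ.* (card ℕ.* card))
        ≡⟨ cong (2 ℕ.*_) (m^[2[1+n]]≡m^n*m^n*[m*m] card d) ⟨
      2 ℕ.* card ^ (2 ℕ.* suc d) ∎
      where open ℕ.≤-Reasoning

corollary5p4 : (d : ℕ) (F : FiniteField) →
    let open FiniteField F in
    (B : Subset d) →
    6 ℕ.* (card ^ (2 ℕ.* d)) < (∣ B ∣ ℕ.* ∣ B ∣) ℕ.* card →
    (α : Vec Carrier d) → All Nonzero α →
    ∃₂ λ (y : Vec Carrier d) (u : Carrier) →
      Nonzero u × ((y +ᵛ (u ·ᵛ α)) ∈ B) × ((y *ᵛ u) ∈ B)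
corollary5p4 zero F B |B|-large [] [] with B [] in []∈B
... | true  = [] , 1# , 1≢0 , []∈B , []∈B
  where open FiniteFieldProperties F
... | false with () ← |B|-large  -- ∣ B ∣ computes to 0
corollary5p4 (suc d) F B |B|-large (α₁ ∷ α′) (α₁≢0 ∷ _) =
  search (Vectors.∃? (λ y → Elements.∃? (witness? y)))
  where
  open FiniteFieldProperties F
  open Slices F B α₁ α′ α₁≢0
  Witness : Vec Carrier (suc d) → Carrier → Set
  Witness y u = Nonzero u × (y +ᵛ (u ·ᵛ α)) ∈ B × (y *ᵛ u) ∈ B
  witness? : ∀ y u → Dec (Witness y u)
  witness? y u = ¬? (u ≟ 0#) ×-dec (B (y +ᵛ (u ·ᵛ α)) Bool.≟ true) ×-dec (B (y *ᵛ u) Bool.≟ true)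
  search : Dec (∃₂ Witness) → ∃₂ Witness
  search (yes witness) = witness
  search (no ∄witness) = ⊥-elim (ℕ.<⇒≱ |B|-large (ℕ.≤-trans
    (∣B∣²*card≤2*card^[2d+2] λ y u u≢0 y+uα∈B yu∈B → ∄witness (y , u , u≢0 , y+uα∈B , yu∈B))
    (ℕ.*-monoˡ-≤ (card ^ (2 ℕ.* suc d)) (ℕ.m≤m+n 2 4))))
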